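{- For hypercubes, $\mathrm{nim}(\mathrm{DNG}(Q_{n}))=0$.
   Context: For $n\ge 2$, the hypercube graph $Q_n$ has vertex set $\{0,1\}^n$ (binary strings of length $n$), with two strings adjacent exactly when they differ in a single digit. For a graph $G=(V,E)$, a set of vertices is geodetically convex if it contains every vertex on every shortest path between two of its vertices; the convex hull $[P]$ is the smallest convex set containing $P$, and $P$ is generating if $[P]=V$. In the avoidance game $\mathrm{DNG}(G)$, two players alternately select previously-unselected vertices such that the selected set never generates; the player who cannot move loses. $\mathrm{nim}$ denotes the nim-number of an impartial game. -}

module Defs where

open import Level using (Lift)
open import Data.Nat using (ℕ; _+_; _<_; _≤_; _^_) renaming (zero to nzero; suc to nsuc)
open import Data.Bool using (Bool; true; false; _≟_)
open import Data.Vec using (Vec; []; _∷_)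
open import Data.List using (List; []; _∷_)
open import Data.List.Membership.Propositional using (_∈_; _∉_)
open import Data.Product using (Σ; _×_; _,_)
open import Data.Empty using (⊥)
open import Relation.Nullary using (¬_; yes; no)
open import Relation.Binary.PropositionalEquality using (_≡_)

record Graph : Set₁ where
  field
    Vertex : Set
    Adj    : Vertex → Vertex → Set
open Graph public

module _ (G : Graph) where

  data Walk : Vertex G → Vertex G → ℕ → Set where
    stay : ∀ u → Walk u u 0
    step : ∀ {u w v l} → Adj G u w → Walk w v l → Walk u v (nsuc l)

  data OnWalk (x : Vertex G) : ∀ {u v l} → Walk u v l → Set where
    here-stay : OnWalk x (stay x)
    here-step : ∀ {w v l} (a : Adj G x w) (p : Walk w v l) → OnWalk x (step a p)
    there     : ∀ {u w v l} (a : Adj G u w) (p : Walk w v l) →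
                OnWalk x p → OnWalk x (step a p)

  Shortest : ∀ {u v l} → Walk u v l → Set
  Shortest {u} {v} {l} _ = ∀ l' → Walk u v l' → l ≤ l'

  Convex : (Vertex G → Set) → Set
  Convex C = ∀ {u v l} (p : Walk u v l) → Shortest p → C u → C v →
             ∀ x → OnWalk x p → C x

  -- P is generating: its convex hull (the smallest convex set containing P,
  -- i.e. the intersection of all convex supersets of P) is all of V.
  Generating : List (Vertex G) → Set₁
  Generating P = ∀ (C : Vertex G → Set) → Convex C →
                 (∀ x → x ∈ P → C x) → ∀ v → C v

  -- The avoidance game DNG(G): a position is the list of selected
  -- vertices; a legal move selects a new vertex keeping the set
  -- non-generating.
  DNGMove : List (Vertex G) → Vertex G → Set₁
  DNGMove P v = v ∉ P × ¬ Generating (v ∷ P)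

  -- NimIs f P k : "the nim-number of position P is k", computed with
  -- recursion depth f.  k is the mex of the nim-numbers of the options:
  -- every j < k is the nim-number of some option, and k is not.
  -- Exact whenever f exceeds the maximal number of remaining moves.
  NimIs : ℕ → List (Vertex G) → ℕ → Set₁
  NimIs nzero     P k = Lift _ ⊥
  NimIs (nsuc f) P k =
    (∀ j → j < k → Σ (Vertex G) λ v → DNGMove P v × NimIs f (v ∷ P) j) ×
    (∀ v → DNGMove P v → ¬ NimIs f (v ∷ P) k)

hamming : ∀ {n} → Vec Bool n → Vec Bool n → ℕ
hamming []       []       = 0
hamming (a ∷ u) (b ∷ v) with a ≟ b
... | yes _ = hamming u v
... | no  _ = nsuc (hamming u v)

Q : ℕ → Graph
Q n = record { Vertex = Vec Bool n ; Adj = λ u v → hamming u v ≡ 1 }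

-- nim(DNG(Q_n)) = k : the starting position (nothing selected) has
-- nim-number k.  Any game has at most 2^n moves, so depth 2^n + 1 is exact.
nimDNG-Q≡ : ℕ → ℕ → Set₁
nimDNG-Q≡ n k = NimIs (Q n) (nsuc (2 ^ n)) [] k

{-# OPTIONS --safe #-}
-- The second player wins by mirroring: answer a vertex v by v with its first
-- bit flipped, keeping the selected set closed under that flip.  Once some
-- vertex p has been selected, the flip of a new vertex v already lies on a
-- geodesic from v to p or to p's flip (whichever has the other first bit), so
-- the answer adds nothing to the convex hull.  On the very first move the two
-- selected vertices form an edge, which is convex and, for n ≥ 2, not all of Q_n.
module Submission where

open import Defs
open import Data.Nat using (ℕ; zero; suc; _+_; _*_; _^_; _≤_; z≤n; s≤s)
open import Data.Nat.Properties
  using (≤-trans; ≤-reflexive; n≤1+n; n<1+n; +-mono-≤; +-monoʳ-<; *-suc)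
open import Data.Bool using (Bool; true; false; not)
open import Data.Bool.Properties using (not-involutive; not-¬)
open import Data.Vec using (Vec; []; _∷_; head; tail)
open import Data.List using (List; []; _∷_)
open import Data.List.Relation.Unary.Any using (here; there)
open import Data.List.Membership.Propositional using (_∈_; _∉_)
open import Data.Product using (Σ-syntax; _×_; _,_)
open import Data.Sum using (_⊎_; inj₁; inj₂)
open import Level using (lower)
open import Function using (_∘_)
open import Relation.Nullary using (¬_)
open import Relation.Binary.PropositionalEquality using (_≡_; _≢_; refl; subst; cong; sym)

module _ (G : Graph) where

  InHull : List (Vertex G) → Vertex G → Set₁
  InHull P x = ∀ C → Convex G C → (∀ y → y ∈ P → C y) → C x

  ¬generating-∷-inHull : ∀ {P x} → InHull P x →
                         ¬ Generating G P → ¬ Generating G (x ∷ P)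
  ¬generating-∷-inHull {P} x∈[P] ¬gen gen = ¬gen λ C convex P⊆C →
    gen C convex λ where
      y (here refl) → x∈[P] C convex P⊆C
      y (there y∈P) → P⊆C y y∈P

  onWalk-length≤1 : ∀ {u v x l} (p : Walk G u v l) → l ≤ 1 →
                    OnWalk G x p → x ≡ u ⊎ x ≡ v
  onWalk-length≤1 (stay _)          _         here-stay             = inj₁ refl
  onWalk-length≤1 (step _ _)        _         (here-step _ _)       = inj₁ refl
  onWalk-length≤1 (step _ (stay _)) (s≤s z≤n) (there _ _ here-stay) = inj₂ refl

  onWalk-start : ∀ {u v l} (p : Walk G u v l) → OnWalk G u p
  onWalk-start (stay u)   = here-stay
  onWalk-start (step a p) = here-step a p

  Edge : Vertex G → Vertex G → Vertex G → Set
  Edge u v x = x ≡ u ⊎ x ≡ v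

  shortest-within-edge : ∀ {u v x y l} (p : Walk G x y l) →
                         Adj G u v → Adj G v u → Shortest G p →
                         Edge u v x → Edge u v y → l ≤ 1
  shortest-within-edge {u} {v} _ uv vu sh (inj₁ refl) (inj₁ refl) = ≤-trans (sh 0 (stay u)) z≤n
  shortest-within-edge {u} {v} _ uv vu sh (inj₁ refl) (inj₂ refl) = sh 1 (step uv (stay v))
  shortest-within-edge {u} {v} _ uv vu sh (inj₂ refl) (inj₁ refl) = sh 1 (step vu (stay u))
  shortest-within-edge {u} {v} _ uv vu sh (inj₂ refl) (inj₂ refl) = ≤-trans (sh 0 (stay v)) z≤n

  edge-convex : ∀ {u v} → Adj G u v → Adj G v u → Convex G (Edge u v)
  edge-convex uv vu p shortest x∈e y∈e z z∈p
    with onWalk-length≤1 p (shortest-within-edge p uv vu shortest x∈e y∈e) z∈p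
  ... | inj₁ refl = x∈e
  ... | inj₂ refl = y∈e

  PairingStrategy : (List (Vertex G) → Set) → Set₁
  PairingStrategy Good = ∀ {P v} → Good P → DNGMove G P v →
    Σ[ w ∈ Vertex G ] DNGMove G (v ∷ P) w × Good (w ∷ v ∷ P)

  -- The depth is odd so that the truncation NimIs G 0 _ _ = ⊥ is only reached
  -- at positions the first player has just moved into.
  pairingStrategy⇒nim≡0 : ∀ {Good} → PairingStrategy Good →
                          ∀ m {P} → Good P → NimIs G (suc (2 * m)) P 0
  pairingStrategy⇒nim≡0 {Good} reply m good = (λ _ ()) , λ _ → refute m good
    where
    refute : ∀ m {P v} → Good P → DNGMove G P v → ¬ NimIs G (2 * m) (v ∷ P) 0
    refute zero    _    _    nim = lower nim
    refute (suc m) {P} {v} good move =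
      subst (λ d → ¬ NimIs G d (v ∷ P) 0) (sym (*-suc 2 m)) answered
      where
      answered : ¬ NimIs G (2 + 2 * m) (v ∷ P) 0
      answered (_ , ¬options) with reply good move
      ... | w , move′ , good′ = ¬options w move′ (pairingStrategy⇒nim≡0 reply m good′)

hamming-refl : ∀ {n} (u : Vec Bool n) → hamming u u ≡ 0
hamming-refl []          = refl
hamming-refl (true ∷ u)  = hamming-refl u
hamming-refl (false ∷ u) = hamming-refl u

hamming-triangle : ∀ {n} (u w v : Vec Bool n) →
                   hamming u v ≤ hamming u w + hamming w v
hamming-triangle []      []      []      = z≤n
hamming-triangle (a ∷ u) (b ∷ w) (c ∷ v) with hamming-triangle u w v
hamming-triangle (true ∷ u)  (true ∷ w)  (true ∷ v)  | uv≤ = uv≤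
hamming-triangle (true ∷ u)  (true ∷ w)  (false ∷ v) | uv≤ = ≤-trans (s≤s uv≤) (+-monoʳ-< _ (n<1+n _))
hamming-triangle (true ∷ u)  (false ∷ w) (true ∷ v)  | uv≤ = ≤-trans uv≤ (+-mono-≤ (n≤1+n _) (n≤1+n _))
hamming-triangle (true ∷ u)  (false ∷ w) (false ∷ v) | uv≤ = s≤s uv≤
hamming-triangle (false ∷ u) (true ∷ w)  (true ∷ v)  | uv≤ = s≤s uv≤
hamming-triangle (false ∷ u) (true ∷ w)  (false ∷ v) | uv≤ = ≤-trans uv≤ (+-mono-≤ (n≤1+n _) (n≤1+n _))
hamming-triangle (false ∷ u) (false ∷ w) (true ∷ v)  | uv≤ = ≤-trans (s≤s uv≤) (+-monoʳ-< _ (n<1+n _))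
hamming-triangle (false ∷ u) (false ∷ w) (false ∷ v) | uv≤ = uv≤

hamming≤length : ∀ {n} {u v : Vec Bool n} {l} → Walk (Q n) u v l → hamming u v ≤ l
hamming≤length (stay u) = ≤-reflexive (hamming-refl u)
hamming≤length {u = u} {v} (step {w = w} uw p) = ≤-trans (hamming-triangle u w v)
  (subst (λ d → d + hamming w v ≤ suc _) (sym uw) (s≤s (hamming≤length p)))

consWalk : ∀ {n} (a : Bool) {u v : Vec Bool n} {l} →
           Walk (Q n) u v l → Walk (Q (suc n)) (a ∷ u) (a ∷ v) l
consWalk a     (stay u)    = stay (a ∷ u)
consWalk true  (step uw p) = step uw (consWalk true p)
consWalk false (step uw p) = step uw (consWalk false p)

hammingWalk : ∀ {n} (u v : Vec Bool n) → Walk (Q n) u v (hamming u v)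
hammingWalk []          []          = stay []
hammingWalk (true ∷ u)  (true ∷ v)  = consWalk true (hammingWalk u v)
hammingWalk (false ∷ u) (false ∷ v) = consWalk false (hammingWalk u v)
hammingWalk (true ∷ u)  (false ∷ v) = step (cong suc (hamming-refl u)) (consWalk false (hammingWalk u v))
hammingWalk (false ∷ u) (true ∷ v)  = step (cong suc (hamming-refl u)) (consWalk true (hammingWalk u v))

flipHead : ∀ {n} → Vec Bool (suc n) → Vec Bool (suc n)
flipHead (a ∷ u) = not a ∷ u

flipHead-involutive : ∀ {n} (v : Vec Bool (suc n)) → flipHead (flipHead v) ≡ v
flipHead-involutive (a ∷ u) = cong (_∷ u) (not-involutive a)

flipHead-≢ : ∀ {n} (v : Vec Bool (suc n)) → flipHead v ≢ v
flipHead-≢ (a ∷ u) eq = not-¬ refl (sym (cong head eq))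

flipHead-adj : ∀ {n} (v : Vec Bool (suc n)) → Adj (Q (suc n)) v (flipHead v)
flipHead-adj (true ∷ u)  = cong suc (hamming-refl u)
flipHead-adj (false ∷ u) = cong suc (hamming-refl u)

flipHead-adj˘ : ∀ {n} (v : Vec Bool (suc n)) → Adj (Q (suc n)) (flipHead v) v
flipHead-adj˘ (true ∷ u)  = cong suc (hamming-refl u)
flipHead-adj˘ (false ∷ u) = cong suc (hamming-refl u)

-- The walk a∷u → (not a)∷u → (not a)∷w is a geodesic.
convex-flipHead : ∀ {n} {C : Vec Bool (suc n) → Set} → Convex (Q (suc n)) C →
                  ∀ a u w → C (a ∷ u) → C (not a ∷ w) → C (not a ∷ u)
convex-flipHead convex a u w au∈C w∈C with a
... | true  = convex (step (flipHead-adj (true ∷ u)) (hammingWalk (false ∷ u) (false ∷ w)))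
                (λ _ → hamming≤length) au∈C w∈C _ (there _ _ (onWalk-start _ (hammingWalk _ _)))
... | false = convex (step (flipHead-adj (false ∷ u)) (hammingWalk (true ∷ u) (true ∷ w)))
                (λ _ → hamming≤length) au∈C w∈C _ (there _ _ (onWalk-start _ (hammingWalk _ _)))

MirrorClosed : ∀ {n} → List (Vec Bool (suc n)) → Set
MirrorClosed P = ∀ x → x ∈ P → flipHead x ∈ P

flipHead-inHull : ∀ {n} {p : Vec Bool (suc n)} {P} → MirrorClosed (p ∷ P) →
                  ∀ v → InHull (Q (suc n)) (v ∷ p ∷ P) (flipHead v)
flipHead-inHull {p = b ∷ w} closed (a ∷ u) C convex P⊆C
  with a | b | P⊆C _ (here refl) | P⊆C _ (there (here refl))
     | P⊆C _ (there (closed _ (here refl)))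
... | true  | true  | v∈C | _   | p̄∈C = convex-flipHead convex true u w v∈C p̄∈C
... | true  | false | v∈C | p∈C | _   = convex-flipHead convex true u w v∈C p∈C
... | false | true  | v∈C | p∈C | _   = convex-flipHead convex false u w v∈C p∈C
... | false | false | v∈C | _   | p̄∈C = convex-flipHead convex false u w v∈C p̄∈C

flipSecond : ∀ {n} → Vec Bool (suc (suc n)) → Vec Bool (suc (suc n))
flipSecond (a ∷ b ∷ u) = a ∷ not b ∷ u

flipSecond-∉-edge : ∀ {n} (v : Vec Bool (suc (suc n))) →
                    ¬ Edge (Q (suc (suc n))) v (flipHead v) (flipSecond v)
flipSecond-∉-edge (a ∷ b ∷ u) (inj₁ eq) = not-¬ refl (sym (cong (head ∘ tail) eq))
flipSecond-∉-edge (a ∷ b ∷ u) (inj₂ eq) = not-¬ refl (cong head eq)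

edge-¬generating : ∀ {n} (v : Vec Bool (suc (suc n))) →
                   ¬ Generating (Q (suc (suc n))) (flipHead v ∷ v ∷ [])
edge-¬generating v gen = flipSecond-∉-edge v
  (gen (Edge (Q _) v (flipHead v))
       (edge-convex (Q _) (flipHead-adj v) (flipHead-adj˘ v))
       edge⊆ (flipSecond v))
  where
  edge⊆ : ∀ x → x ∈ flipHead v ∷ v ∷ [] → Edge (Q _) v (flipHead v) x
  edge⊆ x (here eq)         = inj₂ eq
  edge⊆ x (there (here eq)) = inj₁ eq

mirrorStrategy : ∀ {n} → PairingStrategy (Q (suc (suc n))) MirrorClosed
mirrorStrategy {P = P} {v} closed (v∉P , ¬gen) =
  flipHead v , (v̄∉vP , ¬generating P closed ¬gen) , closed′
  where
  v̄∉vP : flipHead v ∉ v ∷ P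
  v̄∉vP (here eq)     = flipHead-≢ v eq
  v̄∉vP (there v̄∈P) = v∉P (subst (_∈ P) (flipHead-involutive v) (closed _ v̄∈P))
  ¬generating : ∀ P → MirrorClosed P → ¬ Generating _ (v ∷ P) →
                ¬ Generating _ (flipHead v ∷ v ∷ P)
  ¬generating []      _      _    = edge-¬generating v
  ¬generating (p ∷ P) closed ¬gen = ¬generating-∷-inHull _ (flipHead-inHull closed v) ¬gen
  closed′ : MirrorClosed (flipHead v ∷ v ∷ P)
  closed′ x (here refl)         = there (here (flipHead-involutive v))
  closed′ x (there (here refl)) = here refl
  closed′ x (there (there x∈P)) = there (there (closed x x∈P))

proposition7p10 : ∀ (n : ℕ) → 2 ≤ n → nimDNG-Q≡ n 0
proposition7p10 (suc (suc n)) (s≤s (s≤s z≤n)) =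
  pairingStrategy⇒nim≡0 _ mirrorStrategy (2 ^ suc n) λ _ ()
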